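{- Let $m,n,k,l$ be positive integers with $km=nl$ and $m\le n$. Then \[\gamma(A)=\left\lceil \frac{n}{m}\right\rceil\quad\text{for all } A\in\mathcal{A}(m,n;k,l).\]
   Context: $\mathcal{A}(m,n;k,l)$ denotes the class of all $m\times n$ $(0,1)$-matrices with exactly $k$ $1$s in each row and exactly $l$ $1$s in each column. For a $(0,1)$-matrix $A$ and positive integer $t$, the $t$-term rank $\rho_t(A)$ is the maximum number of $1$s of $A$ that can be chosen with at most one chosen $1$ in each column and at most $t$ chosen $1$s in each row. For an $m\times n$ $(0,1)$-matrix $A$ with $m\le n$ and at least one $1$ in each column, the strength $\gamma(A)$ is the smallest positive integer $t$ with $\rho_t(A)=n$. -}

module Defs where

open import Data.Nat using (ℕ; zero; suc; _+_; _*_; _∸_; _≤_; _<_; NonZero)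
open import Data.Nat.DivMod using (_/_)
open import Data.Bool using (Bool; true; false; T; _∧_)
open import Data.Fin using (Fin; zero; suc)
open import Data.Product using (Σ; _×_; ∃-syntax)
open import Relation.Binary.PropositionalEquality using (_≡_)
open import Relation.Nullary using (¬_)

-- An m×n (0,1)-matrix: entry (i , j) is true iff it equals 1.
Matrix : ℕ → ℕ → Set
Matrix m n = Fin m → Fin n → Bool

count : ∀ {n} → (Fin n → Bool) → ℕ
count {zero}  v = 0
count {suc n} v = (if-one (v zero)) + count (λ j → v (suc j))
  where
  if-one : Bool → ℕ
  if-one true  = 1
  if-one false = 0

rowSum : ∀ {m n} → Matrix m n → Fin m → ℕ
rowSum A i = count (A i)

colSum : ∀ {m n} → Matrix m n → Fin n → ℕ
colSum A j = count (λ i → A i j)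

total : ∀ {m n} → Matrix m n → ℕ
total {zero}  A = 0
total {suc m} A = count (A zero) + total (λ i → A (suc i))

InClass : (m n k l : ℕ) → Matrix m n → Set
InClass m n k l A = (∀ i → rowSum A i ≡ k) × (∀ j → colSum A j ≡ l)

_⊆ₘ_ : ∀ {m n} → Matrix m n → Matrix m n → Set
S ⊆ₘ A = ∀ i j → T (S i j) → T (A i j)

IsTChoice : ∀ {m n} → ℕ → Matrix m n → Matrix m n → Set
IsTChoice t A S = (S ⊆ₘ A) × (∀ j → colSum S j ≤ 1) × (∀ i → rowSum S i ≤ t)

TermRank : ∀ {m n} → ℕ → Matrix m n → ℕ → Set
TermRank t A r =
  (∃[ S ] (IsTChoice t A S × total S ≡ r)) ×
  (∀ S → IsTChoice t A S → total S ≤ r)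

Strength : ∀ {m n} → Matrix m n → ℕ → Set
Strength {m} {n} A g =
  1 ≤ g × TermRank g A n × (∀ t → 1 ≤ t → t < g → ¬ TermRank t A n)

⌈_/_⌉ : (a b : ℕ) → .{{NonZero b}} → ℕ
⌈ a / b ⌉ = (a + (b ∸ 1)) / b

module Submission where

-- A t-choice has at most one chosen 1 per column and at most t per row, so it has at most m t
-- chosen 1s; hence ρ_t(A) < n whenever m t < n, that is whenever t < ⌈n/m⌉.
-- Conversely let t = ⌈n/m⌉, so that k m = n l ≤ t m l gives k ≤ t l. A t-choice of size n is an
-- assignment of every column to a row holding one of its 1s with every row load at most t.
-- Start from any assignment; while some row i₀ is overloaded, explore from i₀ the rows reachable
-- by alternating steps (a column assigned to a reached row, then another 1 of that column).
-- If a row with load < t is reached, reassigning the columns along a shortest such path moves one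
-- unit of load there and lowers the total excess Σ (load − t)⁺. Otherwise the reached rows R form
-- a closed set: the columns assigned into R, more than t |R| of them, have all their l 1s inside R,
-- so t |R| l < |R| k ≤ t |R| l, which is absurd.

open import Defs
open import Data.Bool using (Bool; true; false; T; _∧_; _∨_; if_then_else_)
open import Data.Bool.Properties using (T-∧; T-∨; T?)
open import Data.Empty using (⊥; ⊥-elim)
open import Data.Fin using (Fin; zero; suc; _≟_; punchIn)
open import Data.Fin.Properties using (any?; punchInᵢ≢i)
open import Data.Nat using (ℕ; zero; suc; _+_; _*_; _∸_; _≤_; _<_; z≤n; s≤s; z<s; _<?_; >-nonZero; >-nonZero⁻¹)
open import Data.Nat.DivMod using (_%_; m≡m%n+[m/n]*n; m%n<n; m/n*n≤m)
open import Data.Nat.Properties hiding (_≟_)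
open import Data.Product using (_×_; _,_; proj₁; proj₂; ∃-syntax)
open import Data.Sum using (_⊎_; inj₁; inj₂)
open import Function using (_∘_; Equivalence)
open import Relation.Binary.PropositionalEquality
open import Relation.Nullary using (¬_; yes; no; does)
open import Relation.Nullary.Decidable using (_×-dec_; ¬?; dec-true; decidable-stable)
open import Algebra.Properties.Semiring.Sum +-*-semiring
  using (sum; sum-cong-≗; sum-remove; ∑-distrib-+; ∑-comm; *-distribˡ-sum; *-distribʳ-sum)

open Equivalence using (to; from)

𝟙 : Bool → ℕ
𝟙 true  = 1
𝟙 false = 0

δ : ∀ {n} → Fin n → Fin n → ℕ
δ a x = 𝟙 (does (a ≟ x))

does-≟⇒≡ : ∀ {n} {a b : Fin n} → T (does (a ≟ b)) → a ≡ b
does-≟⇒≡ {a = a} {b} t with a ≟ b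
... | yes a≡b = a≡b

¬T⇒≡false : ∀ {b} → ¬ T b → b ≡ false
¬T⇒≡false {true}  ¬t = ⊥-elim (¬t _)
¬T⇒≡false {false} _  = refl

any : ∀ {n} → (Fin n → Bool) → Bool
any {zero}  v = false
any {suc n} v = v zero ∨ any (v ∘ suc)

any-intro : ∀ {n} (v : Fin n → Bool) j → T (v j) → T (any v)
any-intro v zero    t = from T-∨ (inj₁ t)
any-intro v (suc j) t = from T-∨ (inj₂ (any-intro (v ∘ suc) j t))

any-elim : ∀ {n} (v : Fin n → Bool) → T (any v) → ∃[ j ] T (v j)
any-elim {suc n} v t with to T-∨ t
... | inj₁ t₀ = zero , t₀
... | inj₂ t₁ = let j , tj = any-elim (v ∘ suc) t₁ in suc j , tj

any-cong : ∀ {n} {v w : Fin n → Bool} → (∀ x → v x ≡ w x) → any v ≡ any w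
any-cong {zero}  _   = refl
any-cong {suc n} v≗w = cong₂ _∨_ (v≗w zero) (any-cong (v≗w ∘ suc))

𝟙-mono : ∀ {a b} → (T a → T b) → 𝟙 a ≤ 𝟙 b
𝟙-mono {false} _   = z≤n
𝟙-mono {true} {true}  _   = ≤-refl
𝟙-mono {true} {false} a⇒b = ⊥-elim (a⇒b _)

𝟙-mono-< : ∀ {a b} → ¬ T a → T b → 𝟙 a < 𝟙 b
𝟙-mono-< {true}          ¬a _ = ⊥-elim (¬a _)
𝟙-mono-< {false} {true}  _  _ = ≤-refl

count≡sum𝟙 : ∀ {n} (v : Fin n → Bool) → count v ≡ sum (𝟙 ∘ v)
count≡sum𝟙 {zero}  v = refl
count≡sum𝟙 {suc n} v with v zero
... | true  = cong suc (count≡sum𝟙 (v ∘ suc))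
... | false = count≡sum𝟙 (v ∘ suc)

total≡sum : ∀ {m n} (S : Matrix m n) → total S ≡ sum (λ i → sum (λ j → 𝟙 (S i j)))
total≡sum {zero}  S = refl
total≡sum {suc m} S = cong₂ _+_ (count≡sum𝟙 (S zero)) (total≡sum (S ∘ suc))

sum-mono-≤ : ∀ {n} {g h : Fin n → ℕ} → (∀ x → g x ≤ h x) → sum g ≤ sum h
sum-mono-≤ {zero}  _   = z≤n
sum-mono-≤ {suc n} g≤h = +-mono-≤ (g≤h zero) (sum-mono-≤ (g≤h ∘ suc))

sum-mono-< : ∀ {n} {g h : Fin n → ℕ} → (∀ x → g x ≤ h x) → ∀ i → g i < h i → sum g < sum h
sum-mono-< g≤h zero    gi<hi = +-mono-<-≤ gi<hi (sum-mono-≤ (g≤h ∘ suc))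
sum-mono-< g≤h (suc i) gi<hi = +-mono-≤-< (g≤h zero) (sum-mono-< (g≤h ∘ suc) i gi<hi)

sum-const : ∀ {n} c → sum {n} (λ _ → c) ≡ n * c
sum-const {zero}  c = refl
sum-const {suc n} c = cong (c +_) (sum-const {n} c)

sum𝟙≤ : ∀ {n} (v : Fin n → Bool) → sum (𝟙 ∘ v) ≤ n
sum𝟙≤ {n} v = begin
  sum (𝟙 ∘ v)      ≤⟨ sum-mono-≤ (λ x → 𝟙≤1 (v x)) ⟩
  sum {n} (λ _ → 1) ≡⟨ sum-const {n} 1 ⟩
  n * 1            ≡⟨ *-identityʳ n ⟩
  n                ∎
  where
  open ≤-Reasoning
  𝟙≤1 : ∀ b → 𝟙 b ≤ 1
  𝟙≤1 true  = ≤-refl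
  𝟙≤1 false = z≤n

sum𝟙-pos⇒∃ : ∀ {n} (v : Fin n → Bool) → 1 ≤ sum (𝟙 ∘ v) → ∃[ j ] T (v j)
sum𝟙-pos⇒∃ {suc n} v pos with v zero in v₀
... | true  = zero , subst T (sym v₀) _
... | false = let j , tj = sum𝟙-pos⇒∃ (v ∘ suc) pos in suc j , tj

sum-δ* : ∀ {n} (a : Fin n) (h : Fin n → ℕ) → sum (λ x → δ a x * h x) ≡ h a
sum-δ* {suc n} zero    h = begin
  h zero + 0 + sum (λ x → 0 * h (suc x))   ≡⟨ cong₂ _+_ (+-identityʳ (h zero)) (sum-const {n} 0) ⟩
  h zero + n * 0                          ≡⟨ cong (h zero +_) (*-zeroʳ n) ⟩
  h zero + 0                              ≡⟨ +-identityʳ (h zero) ⟩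
  h zero                                  ∎
  where open ≡-Reasoning
sum-δ* {suc n} (suc a) h = sum-δ* a (h ∘ suc)

sum-δ : ∀ {n} (a : Fin n) → sum (δ a) ≡ 1
sum-δ a = trans (sum-cong-≗ (λ x → sym (*-identityʳ (δ a x)))) (sum-δ* a (λ _ → 1))

sum-update : ∀ {n} {g h : Fin n → ℕ} j → (∀ x → x ≢ j → g x ≡ h x) → sum g + h j ≡ sum h + g j
sum-update {suc n} {g} {h} j g≗h = begin
  sum g + h j                      ≡⟨ cong (_+ h j) (sum-remove {i = j} g) ⟩
  g j + rest g + h j               ≡⟨ cong (λ r → g j + r + h j) rest-agree ⟩
  g j + rest h + h j               ≡⟨ +-comm (g j + rest h) (h j) ⟩
  h j + (g j + rest h)             ≡⟨ cong (h j +_) (+-comm (g j) (rest h)) ⟩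
  h j + (rest h + g j)             ≡⟨ +-assoc (h j) (rest h) (g j) ⟨
  h j + rest h + g j               ≡⟨ cong (_+ g j) (sum-remove {i = j} h) ⟨
  sum h + g j                      ∎
  where
  open ≡-Reasoning
  rest : (Fin (suc n) → ℕ) → ℕ
  rest u = sum (u ∘ punchIn j)
  rest-agree : rest g ≡ rest h
  rest-agree = sum-cong-≗ (λ x → g≗h (punchIn j x) (punchInᵢ≢i j x))

total-≤-rows : ∀ {m n} (S : Matrix m n) t → (∀ i → rowSum S i ≤ t) → total S ≤ m * t
total-≤-rows {m} S t rows≤t = begin
  total S                                   ≡⟨ total≡sum S ⟩
  sum (λ i → sum (λ j → 𝟙 (S i j)))         ≤⟨ sum-mono-≤ (λ i → subst (_≤ t) (count≡sum𝟙 (S i)) (rows≤t i)) ⟩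
  sum {m} (λ _ → t)                         ≡⟨ sum-const {m} t ⟩
  m * t                                     ∎
  where open ≤-Reasoning

total-≤-cols : ∀ {m n} (S : Matrix m n) → (∀ j → colSum S j ≤ 1) → total S ≤ n
total-≤-cols {m} {n} S cols≤1 = begin
  total S                                   ≡⟨ total≡sum S ⟩
  sum (λ i → sum (λ j → 𝟙 (S i j)))         ≡⟨ ∑-comm (λ i j → 𝟙 (S i j)) ⟩
  sum (λ j → sum (λ i → 𝟙 (S i j)))         ≤⟨ sum-mono-≤ (λ j → subst (_≤ 1) (count≡sum𝟙 (λ i → S i j)) (cols≤1 j)) ⟩
  sum {n} (λ _ → 1)                         ≡⟨ sum-const {n} 1 ⟩
  n * 1                                     ≡⟨ *-identityʳ n ⟩
  n                                         ∎
  where open ≤-Reasoning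

neighbourhood-bound : ∀ {m n k l} {A : Matrix m n} → InClass m n k l A →
  (C : Fin n → Bool) (R : Fin m → Bool) → (∀ i j → T (C j) → T (A i j) → T (R i)) →
  sum (𝟙 ∘ C) * l ≤ sum (𝟙 ∘ R) * k
neighbourhood-bound {k = k} {l} {A} (rows , cols) C R C⇒R = begin
  sum (𝟙 ∘ C) * l                                     ≡⟨ *-distribʳ-sum l (𝟙 ∘ C) ⟩
  sum (λ j → 𝟙 (C j) * l)                             ≡⟨ sum-cong-≗ (λ j → cong (𝟙 (C j) *_) (colSum≡ j)) ⟩
  sum (λ j → 𝟙 (C j) * sum (λ i → 𝟙 (A i j)))         ≡⟨ sum-cong-≗ (λ j → *-distribˡ-sum (𝟙 (C j)) (λ i → 𝟙 (A i j))) ⟩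
  sum (λ j → sum (λ i → 𝟙 (C j) * 𝟙 (A i j)))         ≤⟨ sum-mono-≤ (λ j → sum-mono-≤ (λ i → C≤R i j)) ⟩
  sum (λ j → sum (λ i → 𝟙 (R i) * 𝟙 (A i j)))         ≡⟨ ∑-comm (λ i j → 𝟙 (R i) * 𝟙 (A i j)) ⟨
  sum (λ i → sum (λ j → 𝟙 (R i) * 𝟙 (A i j)))         ≡⟨ sum-cong-≗ (λ i → *-distribˡ-sum (𝟙 (R i)) (λ j → 𝟙 (A i j))) ⟨
  sum (λ i → 𝟙 (R i) * sum (λ j → 𝟙 (A i j)))         ≡⟨ sum-cong-≗ (λ i → cong (𝟙 (R i) *_) (rowSum≡ i)) ⟩
  sum (λ i → 𝟙 (R i) * k)                             ≡⟨ *-distribʳ-sum k (𝟙 ∘ R) ⟨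
  sum (𝟙 ∘ R) * k                                     ∎
  where
  open ≤-Reasoning
  colSum≡ : ∀ j → l ≡ sum (λ i → 𝟙 (A i j))
  colSum≡ j = trans (sym (cols j)) (count≡sum𝟙 (λ i → A i j))
  rowSum≡ : ∀ i → sum (λ j → 𝟙 (A i j)) ≡ k
  rowSum≡ i = trans (sym (count≡sum𝟙 (A i))) (rows i)
  C≤R : ∀ i j → 𝟙 (C j) * 𝟙 (A i j) ≤ 𝟙 (R i) * 𝟙 (A i j)
  C≤R i j with C j in cj | A i j in aij
  ... | false | _     = z≤n
  ... | true  | false = ≤-reflexive (sym (*-zeroʳ (𝟙 (R i))))
  ... | true  | true  with R i | C⇒R i j (subst T (sym cj) _) (subst T (sym aij) _)
  ...   | true | _ = ≤-refl

module Assignment {M N : ℕ} (A : Matrix M N) where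

  Valid : (Fin N → Fin M) → Set
  Valid f = ∀ j → T (A (f j) j)

  load : (Fin N → Fin M) → Fin M → ℕ
  load f i = sum (λ j → δ (f j) i)

  sum-load* : ∀ f (g : Fin M → ℕ) → sum (λ i → load f i * g i) ≡ sum (g ∘ f)
  sum-load* f g = begin
    sum (λ i → load f i * g i)                   ≡⟨ sum-cong-≗ (λ i → *-distribʳ-sum (g i) (λ j → δ (f j) i)) ⟩
    sum (λ i → sum (λ j → δ (f j) i * g i))      ≡⟨ ∑-comm (λ i j → δ (f j) i * g i) ⟩
    sum (λ j → sum (λ i → δ (f j) i * g i))      ≡⟨ sum-cong-≗ (λ j → sum-δ* (f j) g) ⟩
    sum (g ∘ f)                                  ∎
    where open ≡-Reasoning

  choice : (Fin N → Fin M) → Matrix M N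
  choice f i j = does (f j ≟ i)

  choice-isTChoice : ∀ f t → Valid f → (∀ i → load f i ≤ t) → IsTChoice t A (choice f)
  choice-isTChoice f t valid load≤t =
    (λ i j chosen → subst (λ i → T (A i j)) (does-≟⇒≡ chosen) (valid j)) ,
    (λ j → ≤-reflexive (trans (count≡sum𝟙 (λ i → choice f i j)) (sum-δ (f j)))) ,
    (λ i → subst (_≤ t) (sym (count≡sum𝟙 (choice f i))) (load≤t i))

  choice-total : ∀ f → total (choice f) ≡ N
  choice-total f = begin
    total (choice f)                              ≡⟨ total≡sum (choice f) ⟩
    sum (λ i → sum (λ j → δ (f j) i))             ≡⟨ ∑-comm (λ i j → δ (f j) i) ⟩
    sum (λ j → sum (δ (f j)))                     ≡⟨ sum-cong-≗ (sum-δ ∘ f) ⟩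
    sum {N} (λ _ → 1)                             ≡⟨ sum-const {N} 1 ⟩
    N * 1                                         ≡⟨ *-identityʳ N ⟩
    N                                             ∎
    where open ≡-Reasoning

  -- load f′ is load f with one unit moved from row a to row b, stated without subtraction.
  LoadMoved : (f f′ : Fin N → Fin M) (a b : Fin M) → Set
  LoadMoved f f′ a b = ∀ x → load f′ x + δ a x ≡ load f x + δ b x

  _[_↦_] : (Fin N → Fin M) → Fin N → Fin M → Fin N → Fin M
  (f [ j ↦ i ]) j′ = if does (j ≟ j′) then i else f j′

  [↦]-same : ∀ f j i → (f [ j ↦ i ]) j ≡ i
  [↦]-same f j i rewrite dec-true (j ≟ j) refl = refl

  [↦]-other : ∀ f {j} i j′ → j′ ≢ j → (f [ j ↦ i ]) j′ ≡ f j′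
  [↦]-other f {j} i j′ j′≢j with j ≟ j′
  ... | yes j≡j′ = ⊥-elim (j′≢j (sym j≡j′))
  ... | no  _    = refl

  [↦]-valid : ∀ {f} j i → Valid f → T (A i j) → Valid (f [ j ↦ i ])
  [↦]-valid j i valid aij j′ with j ≟ j′
  ... | yes refl = aij
  ... | no  _    = valid j′

  [↦]-load : ∀ f j i → LoadMoved f (f [ j ↦ i ]) (f j) i
  [↦]-load f j i x =
    subst (λ y → load (f [ j ↦ i ]) x + δ (f j) x ≡ load f x + δ y x) ([↦]-same f j i)
      (sum-update j (λ j′ j′≢j → cong (λ y → δ y x) ([↦]-other f i j′ j′≢j)))

  -- Rows to which one unit of load can be passed from i₀ by at most d successive reassignments.
  Reach : (Fin N → Fin M) → Fin M → ℕ → Fin M → Bool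
  Reach f i₀ zero    i = does (i₀ ≟ i)
  Reach f i₀ (suc d) i = Reach f i₀ d i ∨ any (λ j → Reach f i₀ d (f j) ∧ A i j)

  Reach-start : ∀ f i₀ d → T (Reach f i₀ d i₀)
  Reach-start f i₀ zero    rewrite dec-true (i₀ ≟ i₀) refl = _
  Reach-start f i₀ (suc d) = from T-∨ (inj₁ (Reach-start f i₀ d))

  Reach-step : ∀ f i₀ d {i} j → T (Reach f i₀ d (f j)) → T (A i j) → T (Reach f i₀ (suc d) i)
  Reach-step f i₀ d j r aij = from T-∨ (inj₂ (any-intro _ j (from T-∧ (r , aij))))

  Reach-mono : ∀ f i₀ {e d} i → e ≤ d → T (Reach f i₀ e i) → T (Reach f i₀ d i)
  Reach-mono f i₀ i e≤d r with m≤n⇒m<n∨m≡n e≤d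
  ... | inj₂ refl = r
  ... | inj₁ (s≤s e≤d′) = from T-∨ (inj₁ (Reach-mono f i₀ i e≤d′ r))

  Reach-reassign : ∀ {f f′ i₀} j → (∀ x → x ≢ j → f′ x ≡ f x) → ∀ d →
    (∀ e → e < d → ¬ T (Reach f i₀ e (f j)) × ¬ T (Reach f i₀ e (f′ j))) →
    ∀ i → Reach f′ i₀ d i ≡ Reach f i₀ d i
  Reach-reassign j agree zero    unreached i = refl
  Reach-reassign {f} {f′} {i₀} j agree (suc e) unreached i =
    cong₂ _∨_ (same i) (any-cong edge)
    where
    same : ∀ i → Reach f′ i₀ e i ≡ Reach f i₀ e i
    same = Reach-reassign j agree e (λ e′ e′<e → unreached e′ (m<n⇒m<1+n e′<e))
    edge : ∀ j′ → (Reach f′ i₀ e (f′ j′) ∧ A i j′) ≡ (Reach f i₀ e (f j′) ∧ A i j′)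
    edge j′ with j′ ≟ j
    ... | no j′≢j rewrite agree j′ j′≢j = cong (_∧ A i j′) (same (f j′))
    ... | yes refl rewrite same (f′ j′)
                         | ¬T⇒≡false (proj₁ (unreached e ≤-refl))
                         | ¬T⇒≡false (proj₂ (unreached e ≤-refl)) = refl

  -- Reassign the column that first reached i, then pass the load on from its old row.
  augment : ∀ {f i₀} d → Valid f → ∀ i → T (Reach f i₀ d i) → ∃[ f′ ] Valid f′ × LoadMoved f f′ i₀ i
  augment {i₀ = i₀} zero valid i r with does-≟⇒≡ {a = i₀} {i} r
  ... | refl = _ , valid , λ x → refl
  augment {f} {i₀} (suc d) valid i r with Reach f i₀ d i in earlier
  ... | true  = augment d valid i (subst T (sym earlier) _)
  ... | false = f′ , valid′ , λ x → trans (moved x) ([↦]-load f j i x)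
    where
    edge = any-elim (λ j → Reach f i₀ d (f j) ∧ A i j) r
    j = proj₁ edge
    rj = proj₁ (to T-∧ (proj₂ edge))
    aij = proj₂ (to T-∧ (proj₂ edge))
    unreached : ∀ e → e < d → ¬ T (Reach f i₀ e (f j)) × ¬ T (Reach f i₀ e ((f [ j ↦ i ]) j))
    unreached e e<d =
      (λ rj′ → subst T earlier (Reach-mono f i₀ i e<d (Reach-step f i₀ e j rj′ aij))) ,
      (λ ri → subst T earlier (Reach-mono f i₀ i (<⇒≤ e<d) (subst (T ∘ Reach f i₀ e) ([↦]-same f j i) ri)))
    rj′ : T (Reach (f [ j ↦ i ]) i₀ d (f j))
    rj′ = subst T (sym (Reach-reassign j (λ j′ → [↦]-other f i j′) d unreached (f j))) rj
    rest = augment d ([↦]-valid j i valid aij) (f j) rj′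
    f′ = proj₁ rest
    valid′ = proj₁ (proj₂ rest)
    moved = proj₂ (proj₂ rest)

  Closed : (Fin N → Fin M) → (Fin M → Bool) → Set
  Closed f R = ∀ i j → T (R (f j)) → T (A i j) → T (R i)

  Reach-grows : ∀ f i₀ d → (∃[ e ] Closed f (Reach f i₀ e)) ⊎ (d < sum (𝟙 ∘ Reach f i₀ d))
  Reach-grows f i₀ zero = inj₂ (≤-reflexive (sym (sum-δ i₀)))
  Reach-grows f i₀ (suc d) with Reach-grows f i₀ d
  ... | inj₁ closed = inj₁ closed
  ... | inj₂ d<size with any? (λ i → T? (Reach f i₀ (suc d) i) ×-dec ¬? (T? (Reach f i₀ d i)))
  ... | yes (i , new , ¬old) = inj₂ (<-≤-trans (s≤s d<size)
          (sum-mono-< (λ x → 𝟙-mono (λ old → from T-∨ (inj₁ old))) i (𝟙-mono-< ¬old new)))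
  ... | no ∄new = inj₁ (d , λ i j rj aij →
          decidable-stable (T? _) (λ ¬old → ∄new (i , Reach-step f i₀ d j rj aij , ¬old)))

  Reach-closes : ∀ f i₀ → ∃[ e ] Closed f (Reach f i₀ e)
  Reach-closes f i₀ with Reach-grows f i₀ M
  ... | inj₁ closed = closed
  ... | inj₂ M<size = ⊥-elim (<⇒≱ M<size (sum𝟙≤ (Reach f i₀ M)))

excess-transfer : ∀ {g′ g t} a b → g′ + 𝟙 a ≡ g + 𝟙 b → (T a → t < g) → (T b → g < t) →
  g′ ∸ t + 𝟙 a ≤ g ∸ t
excess-transfer {g′} {g} false false eq _ _
  rewrite +-identityʳ g′ | +-identityʳ g | eq = ≤-reflexive (+-identityʳ _)
excess-transfer {g′} {g} {t} true false eq over _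
  rewrite +-identityʳ g | sym eq = ≤-reflexive (sym (+-∸-comm 1 (≤-pred (subst (t <_) (+-comm g′ 1) (over _)))))
excess-transfer {g′} {g} {t} false true eq _ under
  rewrite +-identityʳ g′ | eq | m≤n⇒m∸n≡0 (subst (_≤ t) (+-comm 1 g) (under _)) = z≤n
excess-transfer true true _ over under = ⊥-elim (<⇒≱ (over _) (<⇒≤ (under _)))

module Balancing {M N k l : ℕ} (A : Matrix M N) (A∈ : InClass M N k l A)
                 (t : ℕ) (k≤tl : k ≤ t * l) (l≥1 : 1 ≤ l) where
  open Assignment A

  excess : (Fin N → Fin M) → ℕ
  excess f = sum (λ i → load f i ∸ t)

  excess-moved : ∀ {f f′ i₀ i} → LoadMoved f f′ i₀ i → t < load f i₀ → load f i < t →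
    excess f′ < excess f
  excess-moved {f} {f′} {i₀} {i} moved over under = begin-strict
    excess f′                                    <⟨ n<1+n _ ⟩
    suc (excess f′)                              ≡⟨ +-comm 1 (excess f′) ⟩
    excess f′ + 1                                ≡⟨ cong (excess f′ +_) (sum-δ i₀) ⟨
    excess f′ + sum (δ i₀)                       ≡⟨ ∑-distrib-+ (λ x → load f′ x ∸ t) (δ i₀) ⟨
    sum (λ x → load f′ x ∸ t + δ i₀ x)           ≤⟨ sum-mono-≤ pointwise ⟩
    excess f                                     ∎
    where
    open ≤-Reasoning
    pointwise : ∀ x → load f′ x ∸ t + δ i₀ x ≤ load f x ∸ t
    pointwise x = excess-transfer (does (i₀ ≟ x)) (does (i ≟ x)) (moved x)
      (λ i₀≡x → subst (λ y → t < load f y) (does-≟⇒≡ i₀≡x) over)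
      (λ i≡x → subst (λ y → load f y < t) (does-≟⇒≡ i≡x) under)

  no-saturated-closed-set : ∀ f (R : Fin M → Bool) {i₀} → Closed f R → T (R i₀) → t < load f i₀ →
    (∀ i → T (R i) → t ≤ load f i) → ⊥
  no-saturated-closed-set f R {i₀} closed ri₀ over saturated =
    <⇒≱ t*r<c (*-cancelʳ-≤ c (t * r) l {{>-nonZero l≥1}} c*l≤t*r*l)
    where
    r = sum (𝟙 ∘ R)
    c = sum (𝟙 ∘ R ∘ f)
    c*l≤t*r*l : c * l ≤ t * r * l
    c*l≤t*r*l = begin
      c * l           ≤⟨ neighbourhood-bound A∈ (R ∘ f) R closed ⟩
      r * k           ≤⟨ *-monoʳ-≤ r k≤tl ⟩
      r * (t * l)     ≡⟨ *-assoc r t l ⟨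
      r * t * l       ≡⟨ cong (_* l) (*-comm r t) ⟩
      t * r * l       ∎
      where open ≤-Reasoning
    pointwise : ∀ i → t * 𝟙 (R i) + δ i₀ i ≤ load f i * 𝟙 (R i)
    pointwise i with R i in ri | i₀ ≟ i
    ... | false | no  _    rewrite *-zeroʳ t | *-zeroʳ (load f i) = z≤n
    ... | false | yes refl = ⊥-elim (subst T ri ri₀)
    ... | true  | no  _    rewrite *-identityʳ t | *-identityʳ (load f i) | +-identityʳ t =
                             saturated i (subst T (sym ri) _)
    ... | true  | yes refl rewrite *-identityʳ t | *-identityʳ (load f i) = subst (_≤ load f i) (+-comm 1 t) over
    t*r<c : t * r < c
    t*r<c = begin-strict
      t * r                                        <⟨ n<1+n _ ⟩
      suc (t * r)                                  ≡⟨ +-comm 1 (t * r) ⟩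
      t * r + 1                                    ≡⟨ cong₂ _+_ (sym (*-distribˡ-sum t (𝟙 ∘ R))) (sum-δ i₀) ⟨
      sum (λ i → t * 𝟙 (R i)) + sum (δ i₀)         ≡⟨ ∑-distrib-+ (λ i → t * 𝟙 (R i)) (δ i₀) ⟨
      sum (λ i → t * 𝟙 (R i) + δ i₀ i)             ≤⟨ sum-mono-≤ pointwise ⟩
      sum (λ i → load f i * 𝟙 (R i))               ≡⟨ sum-load* f (𝟙 ∘ R) ⟩
      c                                            ∎
      where open ≤-Reasoning

  reduce-excess : ∀ f → Valid f → ∀ i₀ → t < load f i₀ → ∃[ f′ ] Valid f′ × excess f′ < excess f
  reduce-excess f valid i₀ over with Reach-closes f i₀
  ... | e , closed with any? (λ i → T? (Reach f i₀ e i) ×-dec (load f i <? t))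
  ... | yes (i , ri , under) =
    let f′ , valid′ , moved = augment e valid i ri in f′ , valid′ , excess-moved {f} {f′} {i₀} {i} moved over under
  ... | no ∄under = ⊥-elim (no-saturated-closed-set f (Reach f i₀ e) closed (Reach-start f i₀ e) over
                             (λ i ri → ≮⇒≥ (λ under → ∄under (i , ri , under))))

  balance : ∀ p f → Valid f → excess f ≤ p → ∃[ f′ ] Valid f′ × (∀ i → load f′ i ≤ t)
  balance p f valid bound with any? (λ i → t <? load f i)
  ... | no ∄over = f , valid , λ i → ≮⇒≥ (λ over → ∄over (i , over))
  ... | yes (i₀ , over) with reduce-excess f valid i₀ over | p
  ...   | _ , _ , smaller       | zero   = ⊥-elim (n≮0 (<-≤-trans smaller bound))
  ...   | f′ , valid′ , smaller | suc p′ = balance p′ f′ valid′ (≤-pred (<-≤-trans smaller bound))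

  initial : ∃[ f ] Valid f
  initial = proj₁ ∘ nonzero , proj₂ ∘ nonzero
    where
    nonzero : ∀ j → ∃[ i ] T (A i j)
    nonzero j = sum𝟙-pos⇒∃ (λ i → A i j)
      (subst (1 ≤_) (trans (sym (proj₂ A∈ j)) (count≡sum𝟙 (λ i → A i j))) l≥1)

  balanced : ∃[ f ] Valid f × (∀ i → load f i ≤ t)
  balanced = balance _ (proj₁ initial) (proj₂ initial) ≤-refl

≤⌈/⌉* : ∀ a b → a ≤ ⌈ a / suc b ⌉ * suc b
≤⌈/⌉* a b = +-cancelʳ-≤ b a (q * suc b) (begin
  a + b                         ≡⟨ m≡m%n+[m/n]*n (a + b) (suc b) ⟩
  (a + b) % suc b + q * suc b   ≤⟨ +-monoˡ-≤ (q * suc b) (≤-pred (m%n<n (a + b) (suc b))) ⟩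
  b + q * suc b                 ≡⟨ +-comm b (q * suc b) ⟩
  q * suc b + b                 ∎)
  where
  open ≤-Reasoning
  q = ⌈ a / suc b ⌉

<⌈/⌉⇒*< : ∀ a b {t} → t < ⌈ a / suc b ⌉ → suc b * t < a
<⌈/⌉⇒*< a b {t} t<q = +-cancelʳ-≤ b (suc (suc b * t)) a (begin
  suc (suc b * t + b)           ≡⟨ cong suc (trans (+-comm (suc b * t) b) (cong (b +_) (*-comm (suc b) t))) ⟩
  suc t * suc b                 ≤⟨ *-monoˡ-≤ (suc b) t<q ⟩
  ⌈ a / suc b ⌉ * suc b         ≤⟨ m/n*n≤m (a + b) (suc b) ⟩
  a + b                         ∎)
  where open ≤-Reasoning

k≤t*l : ∀ {m n k l t} → k * suc m ≡ n * l → n ≤ t * suc m → k ≤ t * l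
k≤t*l {m} {n} {k} {l} {t} km≡nl n≤tm = *-cancelʳ-≤ k (t * l) (suc m) (begin
  k * suc m        ≡⟨ km≡nl ⟩
  n * l            ≤⟨ *-monoˡ-≤ l n≤tm ⟩
  t * suc m * l    ≡⟨ *-assoc t (suc m) l ⟩
  t * (suc m * l)  ≡⟨ cong (t *_) (*-comm (suc m) l) ⟩
  t * (l * suc m)  ≡⟨ *-assoc t l (suc m) ⟨
  t * l * suc m    ∎)
  where open ≤-Reasoning

corollary3p2 : (m n k l : ℕ) → (k * suc m ≡ suc n * l) → suc m ≤ suc n →
    1 ≤ k → 1 ≤ l →
    (A : Matrix (suc m) (suc n)) → InClass (suc m) (suc n) k l A →
    Strength A ⌈ suc n / suc m ⌉
corollary3p2 m n k l km≡nl _ _ l≥1 A A∈ =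
  g>0 , (balanced-choice , λ S isChoice → total-≤-cols S (proj₁ (proj₂ isChoice))) , below
  where
  open Assignment A
  g = ⌈ suc n / suc m ⌉
  n≤gm : suc n ≤ g * suc m
  n≤gm = ≤⌈/⌉* (suc n) m
  g>0 : 1 ≤ g
  g>0 = >-nonZero⁻¹ g {{m*n≢0⇒m≢0 g {{>-nonZero (<-≤-trans z<s n≤gm)}}}}
  balanced-choice : ∃[ S ] (IsTChoice g A S × total S ≡ suc n)
  balanced-choice with Balancing.balanced A A∈ g (k≤t*l {t = g} km≡nl n≤gm) l≥1
  ... | f , valid , load≤g = choice f , choice-isTChoice f g valid load≤g , choice-total f
  below : ∀ t → 1 ≤ t → t < g → ¬ TermRank t A (suc n)
  below t _ t<g ((S , (_ , _ , rows≤t) , total≡n) , _) =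
    <⇒≱ (<⌈/⌉⇒*< (suc n) m t<g) (subst (_≤ suc m * t) total≡n (total-≤-rows S t rows≤t))
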